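{- Let $P$ be a periodic dealing pattern with period $p$ (i.e. $P_{i+p}=P_i$ for all $i$). Then for all integers $N,k$ with $p<k\le N$, \[T^P_{N,k}=T^P_{N-|P_p|_D,\,k-p}+|P_p|_D.\]
   Context: A dealing pattern $P=P_1P_2P_3\cdots$ is an infinite sequence of letters $U$ and $D$ containing infinitely many $D$'s. Dealing a deck of $N$ cards (positions $1,\dots,N$ from the top) by $P$ means: process the letters in order; for a $U$ move the top card to the bottom; for a $D$ remove the top card (deal it); stop when all $N$ cards are dealt. For $1\le k\le N$, $T^P_{N,k}$ is the number $j$ such that the card initially at position $k$ is the $j$th card dealt. $|P_p|_D$ is the number of $D$'s among the first $p$ letters of $P$. -}

module Defs where

open import Data.Nat using (ℕ; zero; suc; _+_; _∸_; _≤_)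
open import Data.List using (List; []; _∷_; _++_; map; upTo)
open import Data.Maybe using (Maybe; just; nothing)
open import Data.Product using (Σ; ∃; _×_; _,_)
open import Relation.Binary.PropositionalEquality using (_≡_)

data Letter : Set where
  U D : Letter

-- A dealing pattern P = P₁P₂P₃⋯ is a function ℕ → Letter with
-- P i (0-indexed) standing for the letter P_{i+1}.
Pattern : Set
Pattern = ℕ → Letter

InfinitelyManyD : Pattern → Set
InfinitelyManyD P = ∀ n → ∃ λ m → n ≤ m × P m ≡ D

Periodic : Pattern → ℕ → Set
Periodic P p = ∀ i → P (i + p) ≡ P i

countD : Pattern → ℕ → ℕ
countD P zero = zero
countD P (suc n) with P n
... | U = countD P n
... | D = suc (countD P n)

-- State of a deal: (remaining deck, top card first ; cards dealt so far, in order).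
record State : Set where
  constructor ⟨_,_⟩
  field
    deck  : List ℕ
    dealt : List ℕ
open State public

step : Letter → State → State
step _ ⟨ [] , ds ⟩ = ⟨ [] , ds ⟩
step U ⟨ x ∷ xs , ds ⟩ = ⟨ xs ++ (x ∷ []) , ds ⟩
step D ⟨ x ∷ xs , ds ⟩ = ⟨ xs , ds ++ (x ∷ []) ⟩

-- Initial deck of N cards: positions 1,…,N from the top.
initDeck : ℕ → List ℕ
initDeck N = map suc (upTo N)

run : Pattern → ℕ → ℕ → State
run P N zero = ⟨ initDeck N , [] ⟩
run P N (suc t) = step (P t) (run P N t)

nth : List ℕ → ℕ → Maybe ℕ
nth [] _ = nothing
nth (x ∷ xs) zero = just x
nth (x ∷ xs) (suc i) = nth xs i

-- IsT P N k j : T^P_{N,k} = j, i.e. once all N cards are dealt,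
-- the card initially at position k is the j-th card dealt (j ≥ 1).
IsT : Pattern → ℕ → ℕ → ℕ → Set
IsT P N k j = Σ ℕ λ t → deck (run P N t) ≡ [] × 1 ≤ j × nth (dealt (run P N t)) (j ∸ 1) ≡ just k

{-# OPTIONS --safe #-}
-- Only the identity of card k matters, so replace every card by 1 if it is the
-- watched card and by a blank 0 otherwise; the dealt position of k can be read
-- off the marked deal.  Since k > p, the first p letters only touch blanks:
-- d = |P_p|_D of them are dealt and the other p - d are moved under the deck.
-- The marked deck is then exactly the marked fresh deck of N - d cards watched
-- at card k - p, and by periodicity the remaining letters are P again, so both
-- marked deals coincide except for the d blanks already dealt.
module Submission where

open import Defs
open import Data.Bool using (true; false; if_then_else_)
open import Data.Empty using (⊥-elim)
open import Data.List using (List; []; _∷_; _++_; _∷ʳ_; map; replicate; applyUpTo; upTo)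
open import Data.List.Properties using (map-++; map-∘; map-upTo; ++-assoc; ++-identityʳ)
open import Data.Maybe using (just)
open import Data.Maybe.Properties using (just-injective)
open import Data.Nat using (ℕ; zero; suc; _+_; _∸_; _≤_; _<_; _≡ᵇ_; s≤s; z≤n)
open import Data.Nat.Properties
  using (+-suc; +-comm; +-identityʳ; suc-injective; m+n∸m≡n; m+n∸n≡m; m≤n⇒∃[o]m+o≡n; ≡ᵇ⇒≡; ≡⇒≡ᵇ)
open import Data.Nat.Tactic.RingSolver using (solve-∀)
open import Data.Product using (Σ; _×_; _,_)
import Data.Product as Product
open import Function using (_∘_)
open import Function.Bundles using (_⇔_; mk⇔; Equivalence)
open import Function.Construct.Symmetry using (⇔-sym)
open import Function.Related.Propositional using (module EquationalReasoning)
open import Relation.Binary.PropositionalEquality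

open Equivalence using (to; from)

blanks : ℕ → List ℕ
blanks n = replicate n 0

blanks-++ : ∀ m n → blanks m ++ blanks n ≡ blanks (m + n)
blanks-++ zero    n = refl
blanks-++ (suc m) n = cong (0 ∷_) (blanks-++ m n)

blanks-∷ʳ : ∀ n → blanks n ∷ʳ 0 ≡ blanks (suc n)
blanks-∷ʳ n = trans (blanks-++ n 1) (cong blanks (+-comm n 1))

applyUpTo-const : ∀ {A : Set} (x : A) n → applyUpTo (λ _ → x) n ≡ replicate n x
applyUpTo-const x zero    = refl
applyUpTo-const x (suc n) = cong (x ∷_) (applyUpTo-const x n)

map≡[]⇔ : ∀ {A B : Set} (f : A → B) xs → map f xs ≡ [] ⇔ xs ≡ []
map≡[]⇔ f []       = mk⇔ (λ _ → refl) (λ _ → refl)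
map≡[]⇔ f (x ∷ xs) = mk⇔ (λ ()) (λ ())

mark : ℕ → ℕ → ℕ
mark k x = if x ≡ᵇ k then 1 else 0

mark≡1⇔ : ∀ k x → mark k x ≡ 1 ⇔ x ≡ k
mark≡1⇔ k x with x ≡ᵇ k | ≡ᵇ⇒≡ x k | ≡⇒≡ᵇ x k
... | true  | sound | _        = mk⇔ (λ _ → sound _) (λ _ → refl)
... | false | _     | complete = mk⇔ (λ ()) (λ x≡k → ⊥-elim (complete x≡k))

applyUpTo-mark : ∀ a r → applyUpTo (mark a) (suc (a + r)) ≡ blanks a ++ 1 ∷ blanks r
applyUpTo-mark zero    r = cong (1 ∷_) (applyUpTo-const 0 r)
applyUpTo-mark (suc a) r = cong (0 ∷_) (applyUpTo-mark a r)

map-mark-initDeck : ∀ a r → map (mark (suc a)) (initDeck (suc a + r)) ≡ blanks a ++ 1 ∷ blanks r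
map-mark-initDeck a r = begin
  map (mark (suc a)) (map suc (upTo (suc a + r)))  ≡⟨ map-∘ (upTo (suc a + r)) ⟨
  map (mark (suc a) ∘ suc) (upTo (suc a + r))      ≡⟨ map-upTo _ (suc a + r) ⟩
  applyUpTo (mark a) (suc a + r)                   ≡⟨ applyUpTo-mark a r ⟩
  blanks a ++ 1 ∷ blanks r                         ∎
  where open ≡-Reasoning

nth-mark : ∀ k xs i → nth (map (mark k) xs) i ≡ just 1 ⇔ nth xs i ≡ just k
nth-mark k []       i       = mk⇔ (λ ()) (λ ())
nth-mark k (x ∷ xs) zero    = mk⇔ (cong just ∘ to (mark≡1⇔ k x) ∘ just-injective)
                                   (cong just ∘ from (mark≡1⇔ k x) ∘ just-injective)
nth-mark k (x ∷ xs) (suc i) = nth-mark k xs i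

nth-blanks-++ : ∀ d ys i′ → nth (blanks d ++ ys) i′ ≡ just 1 ⇔ Σ ℕ λ i → i′ ≡ d + i × nth ys i ≡ just 1
nth-blanks-++ zero    ys i′       = mk⇔ (λ e → i′ , refl , e) (λ { (_ , refl , e) → e })
nth-blanks-++ (suc d) ys zero     = mk⇔ (λ ()) (λ { (_ , () , _) })
nth-blanks-++ (suc d) ys (suc i′) = mk⇔
  (λ e → Product.map₂ (Product.map₁ (cong suc)) (to (nth-blanks-++ d ys i′) e))
  (λ (i , eq , e) → from (nth-blanks-++ d ys i′) (i , suc-injective eq , e))

countU : Pattern → ℕ → ℕ
countU P zero = zero
countU P (suc n) with P n
... | U = suc (countU P n)
... | D = countU P n

countU+countD : ∀ P n → countU P n + countD P n ≡ n
countU+countD P zero = refl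
countU+countD P (suc n) with P n
... | U = cong suc (countU+countD P n)
... | D = trans (+-suc (countU P n) (countD P n)) (cong suc (countU+countD P n))

remaining-cards : ∀ P p c r → suc p + c + r ∸ countD P p ≡ suc c + (r + countU P p)
remaining-cards P p c r = begin
  suc p + c + r ∸ d          ≡⟨ cong (λ q → suc q + c + r ∸ d) (countU+countD P p) ⟨
  suc (u + d) + c + r ∸ d    ≡⟨ cong (_∸ d) (rearrange u d c r) ⟩
  suc c + (r + u) + d ∸ d    ≡⟨ m+n∸n≡m (suc c + (r + u)) d ⟩
  suc c + (r + u)            ∎
  where
  open ≡-Reasoning
  u = countU P p
  d = countD P p
  rearrange : ∀ u d c r → suc (u + d) + c + r ≡ suc c + (r + u) + d
  rearrange = solve-∀

watched-card : ∀ p c → suc p + c ∸ p ≡ suc c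
watched-card p c = trans (cong (_∸ p) (sym (+-suc p c))) (m+n∸m≡n p (suc c))

mapState : (ℕ → ℕ) → State → State
mapState f s = ⟨ map f (deck s) , map f (dealt s) ⟩

prependDealt : List ℕ → State → State
prependDealt pre s = ⟨ deck s , pre ++ dealt s ⟩

CommutesWithStep : (State → State) → Set
CommutesWithStep Φ = ∀ l s → Φ (step l s) ≡ step l (Φ s)

mapState-step : ∀ f → CommutesWithStep (mapState f)
mapState-step f l ⟨ []     , ds ⟩ = refl
mapState-step f U ⟨ x ∷ xs , ds ⟩ = cong (λ xs′ → ⟨ xs′ , map f ds ⟩) (map-++ f xs (x ∷ []))
mapState-step f D ⟨ x ∷ xs , ds ⟩ = cong (λ ds′ → ⟨ map f xs , ds′ ⟩) (map-++ f ds (x ∷ []))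

prependDealt-step : ∀ pre → CommutesWithStep (prependDealt pre)
prependDealt-step pre l ⟨ []     , ds ⟩ = refl
prependDealt-step pre U ⟨ x ∷ xs , ds ⟩ = refl
prependDealt-step pre D ⟨ x ∷ xs , ds ⟩ = cong (λ ds′ → ⟨ xs , ds′ ⟩) (sym (++-assoc pre ds (x ∷ [])))

step-finished : ∀ l s → deck s ≡ [] → step l s ≡ s
step-finished l ⟨ [] , ds ⟩ refl = refl

DealsBy : Pattern → (ℕ → State) → Set
DealsBy P σ = ∀ t → σ (suc t) ≡ step (P t) (σ t)

module _ {P : Pattern} where

  run-dealsBy : ∀ N → DealsBy P (run P N)
  run-dealsBy N t = refl

  dealsBy-map : ∀ {σ Φ} → CommutesWithStep Φ → DealsBy P σ → DealsBy P (Φ ∘ σ)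
  dealsBy-map {σ} {Φ} commutes deals t = trans (cong Φ (deals t)) (commutes (P t) (σ t))

  dealsBy-shift : ∀ {σ p} → Periodic P p → DealsBy P σ → DealsBy P (λ t → σ (t + p))
  dealsBy-shift {σ} {p} periodic deals t =
    trans (deals (t + p)) (cong (λ l → step l (σ (t + p))) (periodic t))

  dealsBy-unique : ∀ {σ τ} → DealsBy P σ → DealsBy P τ → σ 0 ≡ τ 0 → ∀ t → σ t ≡ τ t
  dealsBy-unique dealsσ dealsτ σ0≡τ0 zero    = σ0≡τ0
  dealsBy-unique dealsσ dealsτ σ0≡τ0 (suc t) =
    trans (dealsσ t) (trans (cong (step (P t)) (dealsBy-unique dealsσ dealsτ σ0≡τ0 t)) (sym (dealsτ t)))

  dealsBy-finished : ∀ {σ} → DealsBy P σ → ∀ t → deck (σ t) ≡ [] → ∀ n → σ (t + n) ≡ σ t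
  dealsBy-finished {σ} deals t finished zero    = cong σ (+-identityʳ t)
  dealsBy-finished {σ} deals t finished (suc n) rewrite +-suc t n =
    trans (deals (t + n)) (trans (cong (step (P (t + n))) (dealsBy-finished deals t finished n))
                                 (step-finished (P (t + n)) (σ t) finished))

  dealsBy-blanks : ∀ {σ} → DealsBy P σ → ∀ t r rest → σ 0 ≡ ⟨ blanks (t + r) ++ rest , [] ⟩ →
    σ t ≡ ⟨ blanks r ++ rest ++ blanks (countU P t) , blanks (countD P t) ⟩
  dealsBy-blanks deals zero r rest σ0 =
    trans σ0 (cong (λ rest′ → ⟨ blanks r ++ rest′ , [] ⟩) (sym (++-identityʳ rest)))
  dealsBy-blanks deals (suc t) r rest σ0
    rewrite deals t
          | dealsBy-blanks deals t (suc r) rest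
              (trans σ0 (cong (λ n → ⟨ blanks n ++ rest , [] ⟩) (sym (+-suc t r))))
    with P t
  ... | U = cong (λ xs → ⟨ xs , blanks (countD P t) ⟩) (begin
          (blanks r ++ rest ++ blanks (countU P t)) ∷ʳ 0  ≡⟨ ++-assoc (blanks r) _ (0 ∷ []) ⟩
          blanks r ++ (rest ++ blanks (countU P t)) ∷ʳ 0  ≡⟨ cong (blanks r ++_) (++-assoc rest _ (0 ∷ [])) ⟩
          blanks r ++ rest ++ blanks (countU P t) ∷ʳ 0    ≡⟨ cong (λ bs → blanks r ++ rest ++ bs) (blanks-∷ʳ _) ⟩
          blanks r ++ rest ++ blanks (suc (countU P t))   ∎)
    where open ≡-Reasoning
  ... | D = cong (λ ds → ⟨ blanks r ++ rest ++ blanks (countU P t) , ds ⟩) (blanks-∷ʳ _)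

DealtAt : ℕ → ℕ → State → Set
DealtAt k i s = deck s ≡ [] × nth (dealt s) i ≡ just k

DealtAt-mark : ∀ k i s → DealtAt 1 i (mapState (mark k) s) ⇔ DealtAt k i s
DealtAt-mark k i s = mk⇔ (Product.map (to deck⇔) (to nth⇔)) (Product.map (from deck⇔) (from nth⇔))
  where
  deck⇔ = map≡[]⇔ (mark k) (deck s)
  nth⇔  = nth-mark k (dealt s) i

DealtAt-prependBlanks : ∀ d i′ s →
  DealtAt 1 i′ (prependDealt (blanks d) s) ⇔ Σ ℕ λ i → i′ ≡ d + i × DealtAt 1 i s
DealtAt-prependBlanks d i′ s = mk⇔
  (λ (finished , e) → let (i , eq , e′) = to nth⇔ e in i , eq , finished , e′)
  (λ (i , eq , finished , e) → finished , from nth⇔ (i , eq , e))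
  where nth⇔ = nth-blanks-++ d (dealt s) i′

module _ {P : Pattern} {p : ℕ} (periodic : Periodic P p) (c r : ℕ) where

  private
    k = suc (p + c)
    N = k + r
    d = countD P p
    M = suc c + (r + countU P p)

  marked-after-period :
    mapState (mark k) (run P N p) ≡ prependDealt (blanks d) (mapState (mark (suc c)) (run P M 0))
  marked-after-period = begin
    mapState (mark k) (run P N p)
      ≡⟨ dealsBy-blanks marked-big p c (1 ∷ blanks r) marked-big-0 ⟩
    ⟨ blanks c ++ (1 ∷ blanks r) ++ blanks u , blanks d ⟩
      ≡⟨ cong₂ ⟨_,_⟩ deck≡ (++-identityʳ (blanks d)) ⟨
    prependDealt (blanks d) (mapState (mark (suc c)) (run P M 0))
      ∎
    where
    open ≡-Reasoning
    u = countU P p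
    marked-big = dealsBy-map (mapState-step (mark k)) (run-dealsBy N)
    marked-big-0 = cong (λ xs → ⟨ xs , [] ⟩) (map-mark-initDeck (p + c) r)
    deck≡ : map (mark (suc c)) (initDeck M) ≡ blanks c ++ (1 ∷ blanks r) ++ blanks u
    deck≡ = trans (map-mark-initDeck c (r + u)) (cong (λ bs → blanks c ++ 1 ∷ bs) (sym (blanks-++ r u)))

  marked-runs-agree : ∀ t →
    mapState (mark k) (run P N (t + p)) ≡ prependDealt (blanks d) (mapState (mark (suc c)) (run P M t))
  marked-runs-agree = dealsBy-unique
    (dealsBy-map (mapState-step (mark k)) (dealsBy-shift periodic (run-dealsBy N)))
    (dealsBy-map (prependDealt-step (blanks d)) (dealsBy-map (mapState-step (mark (suc c))) (run-dealsBy M)))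
    marked-after-period

  DealtAt-shift : ∀ t i′ →
    DealtAt k i′ (run P N (t + p)) ⇔ Σ ℕ λ i → i′ ≡ d + i × DealtAt (suc c) i (run P M t)
  DealtAt-shift t i′ = begin
    DealtAt k i′ big
      ∼⟨ ⇔-sym (DealtAt-mark k i′ big) ⟩
    DealtAt 1 i′ (mapState (mark k) big)
      ≡⟨ cong (DealtAt 1 i′) (marked-runs-agree t) ⟩
    DealtAt 1 i′ (prependDealt (blanks d) (mapState (mark (suc c)) small))
      ∼⟨ DealtAt-prependBlanks d i′ _ ⟩
    (Σ ℕ λ i → i′ ≡ d + i × DealtAt 1 i (mapState (mark (suc c)) small))
      ∼⟨ mk⇔ (Product.map₂ (Product.map₂ (to marked))) (Product.map₂ (Product.map₂ (from marked))) ⟩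
    (Σ ℕ λ i → i′ ≡ d + i × DealtAt (suc c) i small)
      ∎
    where
    open EquationalReasoning
    big = run P N (t + p)
    small = run P M t
    marked : ∀ {i} → DealtAt 1 i (mapState (mark (suc c)) small) ⇔ DealtAt (suc c) i small
    marked {i} = DealtAt-mark (suc c) i small

  IsT-shift : ∀ j → IsT P N k j ⇔ Σ ℕ λ j′ → j ≡ j′ + d × IsT P M (suc c) j′
  IsT-shift j = mk⇔ forward backward
    where
    forward : IsT P N k j → Σ ℕ λ j′ → j ≡ j′ + d × IsT P M (suc c) j′
    forward (t , finished , s≤s {n = i′} z≤n , dealt≡)
      with i , refl , finished′ , dealt≡′ ← to (DealtAt-shift t i′)
             (subst (DealtAt k i′) (sym (dealsBy-finished (run-dealsBy N) t finished p)) (finished , dealt≡))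
      = suc i , cong suc (+-comm d i) , t , finished′ , s≤s z≤n , dealt≡′

    backward : (Σ ℕ λ j′ → j ≡ j′ + d × IsT P M (suc c) j′) → IsT P N k j
    backward (zero  , _    , _ , _ , () , _)
    backward (suc i , refl , t , finished , _ , dealt≡) =
      t + p , Product.map₂ (λ dealt≡′ → s≤s z≤n , dealt≡′)
                (from (DealtAt-shift t (i + d)) (i , +-comm i d , finished , dealt≡))

-- IsT asks only for some time at which the deal is over.
mainTheorem13 : (P : Pattern) → InfinitelyManyD P → (p : ℕ) → Periodic P p →
    (N k : ℕ) → p < k → k ≤ N →
    (j : ℕ) → IsT P N k j ⇔ (Σ ℕ λ j′ → j ≡ j′ + countD P p × IsT P (N ∸ countD P p) (k ∸ p) j′)
mainTheorem13 P _ p periodic N k p<k k≤N j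
  with m≤n⇒∃[o]m+o≡n p<k | m≤n⇒∃[o]m+o≡n k≤N
... | c , refl | r , refl
  rewrite remaining-cards P p c r | watched-card p c = IsT-shift periodic c r j
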